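{- Let $M$ be a $\Delta$-matroid over $V$ and let $u\in V$. If $u$ is neither a loop nor a coloop of $M$, then $p_1(M)(y)=p_1(M\setminus u)(y)-p_1(M*u\setminus u)(y)$. If $u$ is a loop of $M$, then $p_1(M)(y)=(1-y)\,p_1(M\setminus u)(y)$. If $u$ is a coloop of $M$, then $p_1(M)(y)=(y-1)\,p_1(M*u\setminus u)(y)$.
   Context: A set system is $N=(W,D)$, $D\subseteq 2^W$, proper if $D\ne\emptyset$. A $\Delta$-matroid is a proper set system such that for all $X,Y\in D$ and $x\in X\triangle Y$ there is $y\in X\triangle Y$ (possibly $y=x$) with $X\triangle\{x,y\}\in D$. Twist $N*X=(W,\{Y\triangle X:Y\in D\})$, $N*u=N*\{u\}$; deletion $N\setminus u=(W\setminus\{u\},\{Y\in D:u\notin Y\})$; operations apply left to right, so $M*u\setminus u=(M*u)\setminus u$. $u$ is a loop of $N$ if no member of $D$ contains $u$, a coloop if every member contains $u$. $d_N=\min\{|Y|:Y\in D\}$ and $p_1(N)(y)=\sum_{X\subseteq W}(-1)^{|X|}y^{d_{N*X}}$. -}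

module Defs where

open import Data.Nat using (ℕ; zero; suc; _⊓_)
open import Data.Integer using (ℤ; _+_; _*_; -_; +_; 1ℤ; _-_)
import Data.Integer as ℤ
open import Data.Bool using (Bool; true; false; _xor_)
import Data.Bool as B
open import Data.Fin using (Fin)
open import Data.Fin.Subset using (Subset; _∈_; _∉_; _∪_; ⁅_⁆; ∣_∣)
open import Data.Vec using (Vec; []; _∷_; zipWith; insertAt)
open import Data.List using (List; []; _∷_; _++_; map; foldr; filter)
open import Data.Maybe using (Maybe; just; nothing)
open import Data.Product using (Σ; ∃; _×_; _,_)
open import Relation.Binary.PropositionalEquality using (_≡_)

record SetSystem (n : ℕ) : Set where
  constructor ⟨_⟩
  field
    D : Subset n → Bool
open SetSystem public

_∈D_ : ∀ {n} → Subset n → SetSystem n → Set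
Y ∈D N = D N Y ≡ true

_△_ : ∀ {n} → Subset n → Subset n → Subset n
_△_ = zipWith _xor_

Proper : ∀ {n} → SetSystem n → Set
Proper N = ∃ λ Y → Y ∈D N

IsDeltaMatroid : ∀ {n} → SetSystem n → Set
IsDeltaMatroid N =
  Proper N ×
  (∀ X Y → X ∈D N → Y ∈D N → ∀ x → x ∈ (X △ Y) →
     Σ _ λ y → y ∈ (X △ Y) × ((X △ (⁅ x ⁆ ∪ ⁅ y ⁆)) ∈D N))

_✶_ : ∀ {n} → SetSystem n → Subset n → SetSystem n
N ✶ X = ⟨ (λ Y → D N (Y △ X)) ⟩

_✶₁_ : ∀ {n} → SetSystem n → Fin n → SetSystem n
N ✶₁ u = N ✶ ⁅ u ⁆

-- deletion N \ u : ground set Fin (suc n) minus u, identified with Fin n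
-- via the order-preserving bijection; a subset Y of W∖{u} corresponds to
-- the subset of W obtained by inserting 'u ∉' at position u.
_∖_ : ∀ {n} → SetSystem (suc n) → Fin (suc n) → SetSystem n
N ∖ u = ⟨ (λ Y → D N (insertAt Y u false)) ⟩

IsLoop : ∀ {n} → SetSystem n → Fin n → Set
IsLoop N u = ∀ Y → Y ∈D N → u ∉ Y

IsColoop : ∀ {n} → SetSystem n → Fin n → Set
IsColoop N u = ∀ Y → Y ∈D N → u ∈ Y

allSubsets : ∀ n → List (Subset n)
allSubsets zero = [] ∷ []
allSubsets (suc n) = map (true ∷_) (allSubsets n) ++ map (false ∷_) (allSubsets n)

minimum : List ℕ → Maybe ℕ
minimum [] = nothing
minimum (x ∷ xs) with minimum xs
... | nothing = just x
... | just m  = just (x ⊓ m)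

-- d_N = min { |Y| : Y ∈ D }; only meaningful for proper N
-- (value 0 for improper N is an irrelevant junk value).
dmin : ∀ {n} → SetSystem n → ℕ
dmin {n} N with minimum (map ∣_∣ (filter (λ Y → B._≟_ (D N Y) true) (allSubsets n)))
... | nothing = 0
... | just m  = m

sign : ℕ → ℤ
sign zero = 1ℤ
sign (suc k) = - sign k

sumℤ : List ℤ → ℤ
sumℤ = foldr _+_ (+ 0)

p₁ : ∀ {n} → SetSystem n → ℤ → ℤ
p₁ {n} N y = sumℤ (map (λ X → sign ∣ X ∣ * (y ℤ.^ dmin (N ✶ X))) (allSubsets n))

module Submission where

-- Pairing each X' ⊆ V∖u with X'+u, p₁(M) = Σ_{X'} (-1)^|X'| (y^d(M*X') -
-- y^d(M*(X'+u)))  (p₁-split).  Here d(M*X') is the least distance |Y △ X'| from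
-- X' to a member Y; members avoiding u are the members of M∖u, members
-- containing u those of (M*u)∖u.  If each member containing u is at most one
-- step farther from X' than some member avoiding u ("domination"), then
-- d(M*X') = d((M∖u)*X')  (dmin-avoid).  Domination follows from the exchange
-- axiom at u when M∖u is proper, and holds vacuously when u is a loop.  As
-- twisting preserves Δ-matroids and d(M*(X'+u)) = d((M*u)*X'), dmin-avoid for
-- M and for M*u gives the generic case; for a loop d(M*(X'+u)) = 1 +
-- d((M∖u)*X')  (dmin-loop); the coloop case is the loop case of M*u, since
-- p₁(M) = -p₁(M*u)  (p₁-twist).

open import Defs
open import Data.Nat using (ℕ; suc; _≤_; s≤s; _⊓_)
import Data.Nat.Properties as ℕP
open import Data.Fin using (Fin; zero; suc)
open import Data.Integer using (ℤ; _*_; _-_; 1ℤ; _+_; -_; _^_)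
import Data.Integer.Properties as ℤP
open import Data.Integer.Tactic.RingSolver using (solve-∀)
open import Data.Bool using (true; false; not; _xor_)
import Data.Bool as Bool
open import Data.Bool.Properties using (xor-assoc; xor-comm; xor-identityʳ; xor-same; ¬-not)
open import Data.Vec using ([]; _∷_; lookup; insertAt; removeAt)
import Data.Vec.Properties as VecP
open import Data.Fin.Subset using (Subset; ⁅_⁆; _∪_; ∣_∣; ⊥; _∈_; _∉_)
open import Data.Fin.Subset.Properties using (x∈⁅x⁆; p⊆p∪q; ∪-identityˡ; ∪-identityʳ)
open import Data.List using (List; []; _∷_; _++_; map; filter)
import Data.List.Properties as ListP
open import Data.List.Relation.Unary.Any using (here; there)
import Data.List.Relation.Unary.Any as Any
open import Data.List.Relation.Unary.All using (All; []; _∷_)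
import Data.List.Relation.Unary.All as All
open import Data.List.Membership.Propositional using () renaming (_∈_ to _∈ₗ_)
import Data.List.Membership.Propositional.Properties as ∈ₗP
open import Data.Maybe using (just; nothing)
open import Data.Product using (∃; _×_; _,_; proj₁; proj₂)
open import Data.Sum using (inj₁; inj₂)
open import Data.Empty using (⊥-elim)
open import Relation.Nullary using (¬_; yes; no)
open import Relation.Nullary.Decidable using (_×-dec_)
open import Relation.Unary using (Decidable)
open import Relation.Binary.PropositionalEquality

Σₛ : ∀ k → (Subset k → ℤ) → ℤ
Σₛ k f = sumℤ (map f (allSubsets k))

sumℤ-++ : ∀ xs ys → sumℤ (xs ++ ys) ≡ sumℤ xs + sumℤ ys
sumℤ-++ [] ys = sym (ℤP.+-identityˡ _)
sumℤ-++ (x ∷ xs) ys = trans (cong (x +_) (sumℤ-++ xs ys)) (sym (ℤP.+-assoc x _ _))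

sum-map-+ : ∀ {A : Set} (f g : A → ℤ) xs →
  sumℤ (map (λ x → f x + g x) xs) ≡ sumℤ (map f xs) + sumℤ (map g xs)
sum-map-+ f g [] = refl
sum-map-+ f g (x ∷ xs) =
  trans (cong (f x + g x +_) (sum-map-+ f g xs)) (interchange (f x) (g x) _ _)
  where
  interchange : ∀ a b c d → (a + b) + (c + d) ≡ (a + c) + (b + d)
  interchange = solve-∀

sum-map-neg : ∀ {A : Set} (f : A → ℤ) xs →
  sumℤ (map (λ x → - f x) xs) ≡ - sumℤ (map f xs)
sum-map-neg f [] = refl
sum-map-neg f (x ∷ xs) =
  trans (cong (- f x +_) (sum-map-neg f xs)) (sym (ℤP.neg-distrib-+ (f x) _))

sum-map-scale : ∀ {A : Set} c (f : A → ℤ) xs →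
  sumℤ (map (λ x → c * f x) xs) ≡ c * sumℤ (map f xs)
sum-map-scale c f [] = sym (ℤP.*-zeroʳ c)
sum-map-scale c f (x ∷ xs) =
  trans (cong (c * f x +_) (sum-map-scale c f xs)) (sym (ℤP.*-distribˡ-+ c (f x) _))

sum-map-- : ∀ {A : Set} (f g : A → ℤ) xs →
  sumℤ (map (λ x → f x - g x) xs) ≡ sumℤ (map f xs) - sumℤ (map g xs)
sum-map-- f g xs =
  trans (sum-map-+ f (λ x → - g x) xs) (cong (sumℤ (map f xs) +_) (sum-map-neg g xs))

Σₛ-ext : ∀ k {f g : Subset k → ℤ} → (∀ X → f X ≡ g X) → Σₛ k f ≡ Σₛ k g
Σₛ-ext k f≗g = cong sumℤ (ListP.map-cong f≗g (allSubsets k))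

Σₛ-cons : ∀ k f → Σₛ (suc k) f ≡ Σₛ k (λ X → f (true ∷ X)) + Σₛ k (λ X → f (false ∷ X))
Σₛ-cons k f = begin
  sumℤ (map f (map (true ∷_) S ++ map (false ∷_) S))
    ≡⟨ cong sumℤ (ListP.map-++ f (map (true ∷_) S) _) ⟩
  sumℤ (map f (map (true ∷_) S) ++ map f (map (false ∷_) S))
    ≡⟨ sumℤ-++ (map f (map (true ∷_) S)) _ ⟩
  sumℤ (map f (map (true ∷_) S)) + sumℤ (map f (map (false ∷_) S))
    ≡⟨ cong₂ _+_ (cong sumℤ (sym (ListP.map-∘ S))) (cong sumℤ (sym (ListP.map-∘ S))) ⟩
  Σₛ k (λ X → f (true ∷ X)) + Σₛ k (λ X → f (false ∷ X)) ∎
  where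
  S = allSubsets k
  open ≡-Reasoning

Σₛ-insertAt : ∀ k (u : Fin (suc k)) f →
  Σₛ (suc k) f ≡ Σₛ k (λ X → f (insertAt X u true) + f (insertAt X u false))
Σₛ-insertAt k zero f = trans (Σₛ-cons k f) (sym (sum-map-+ _ _ (allSubsets k)))
Σₛ-insertAt (suc k) (suc u) f = begin
  Σₛ (suc (suc k)) f
    ≡⟨ Σₛ-cons (suc k) f ⟩
  Σₛ (suc k) (λ X → f (true ∷ X)) + Σₛ (suc k) (λ X → f (false ∷ X))
    ≡⟨ cong₂ _+_ (Σₛ-insertAt k u _) (Σₛ-insertAt k u _) ⟩
  Σₛ k (λ X → f (true ∷ insertAt X u true) + f (true ∷ insertAt X u false))
    + Σₛ k (λ X → f (false ∷ insertAt X u true) + f (false ∷ insertAt X u false))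
    ≡⟨ sym (Σₛ-cons k _) ⟩
  Σₛ (suc k) (λ X → f (insertAt X (suc u) true) + f (insertAt X (suc u) false)) ∎
  where open ≡-Reasoning

∈-allSubsets : ∀ {k} (Y : Subset k) → Y ∈ₗ allSubsets k
∈-allSubsets [] = here refl
∈-allSubsets (true ∷ Y) = ∈ₗP.∈-++⁺ˡ (∈ₗP.∈-map⁺ (true ∷_) (∈-allSubsets Y))
∈-allSubsets {suc k} (false ∷ Y) =
  ∈ₗP.∈-++⁺ʳ (map (true ∷_) (allSubsets k)) (∈ₗP.∈-map⁺ (false ∷_) (∈-allSubsets Y))

subset-search : ∀ {k} {P : Subset k → Set} → Decidable P → ¬ (∀ Y → ¬ P Y) → ∃ P
subset-search {k} P? irrefutable with Any.any? P? (allSubsets k)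
... | yes found = Any.satisfied found
... | no none = ⊥-elim (irrefutable λ Y pY → none (Any.map (λ Y≡ → subst _ Y≡ pY) (∈-allSubsets Y)))

minimum-≢-nothing : ∀ {x} xs → x ∈ₗ xs → minimum xs ≢ nothing
minimum-≢-nothing (y ∷ ys) _ with minimum ys
... | nothing = λ ()
... | just _ = λ ()

minimum-just : ∀ xs m → minimum xs ≡ just m → m ∈ₗ xs × All (m ≤_) xs
minimum-just (x ∷ xs) m eq with minimum xs in eq′
minimum-just (x ∷ []) m refl | nothing = here refl , ℕP.≤-refl ∷ []
minimum-just (x ∷ y ∷ ys) m refl | nothing = ⊥-elim (minimum-≢-nothing (y ∷ ys) (here refl) eq′)
minimum-just (x ∷ xs) m refl | just m′ with minimum-just xs m′ eq′
... | m′∈xs , m′≤xs =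
  attained , ℕP.m⊓n≤m x m′ ∷ All.map (ℕP.≤-trans (ℕP.m⊓n≤n x m′)) m′≤xs
  where
  attained : x ⊓ m′ ∈ₗ (x ∷ xs)
  attained with ℕP.⊓-sel x m′
  ... | inj₁ eq = here eq
  ... | inj₂ eq = there (subst (_∈ₗ xs) (sym eq) m′∈xs)

MinSize : ∀ {k} → SetSystem k → ℕ → Set
MinSize N m = (∃ λ Y → Y ∈D N × ∣ Y ∣ ≡ m) × (∀ Y → Y ∈D N → m ≤ ∣ Y ∣)

memberSizes : ∀ {k} → SetSystem k → List ℕ
memberSizes {k} N = map ∣_∣ (filter (λ Y → Bool._≟_ (D N Y) true) (allSubsets k))

size-listed : ∀ {k} (N : SetSystem k) Y → Y ∈D N → ∣ Y ∣ ∈ₗ memberSizes N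
size-listed N Y Y∈N =
  ∈ₗP.∈-map⁺ ∣_∣ (∈ₗP.∈-filter⁺ (λ Y → Bool._≟_ (D N Y) true) (∈-allSubsets Y) Y∈N)

dmin-minSize : ∀ {k} (N : SetSystem k) → Proper N → MinSize N (dmin N)
dmin-minSize {k} N (Y₀ , Y₀∈N) with minimum (memberSizes N) in eq
... | nothing = ⊥-elim (minimum-≢-nothing _ (size-listed N Y₀ Y₀∈N) eq)
... | just m with minimum-just _ m eq
... | m∈ , m≤ with ∈ₗP.∈-map⁻ ∣_∣ m∈
... | Y , Y∈ , m≡ =
  (Y , proj₂ (∈ₗP.∈-filter⁻ (λ Y → Bool._≟_ (D N Y) true) {xs = allSubsets k} Y∈) , sym m≡)
  , λ Z Z∈N → All.lookup m≤ (size-listed N Z Z∈N)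

minSize-dmin : ∀ {k} (N : SetSystem k) {m} → MinSize N m → dmin N ≡ m
minSize-dmin N ((Y , Y∈N , ∣Y∣≡m) , m≤) with dmin-minSize N (Y , Y∈N)
... | (Y′ , Y′∈N , ∣Y′∣≡d) , d≤ =
  ℕP.≤-antisym (subst (dmin N ≤_) ∣Y∣≡m (d≤ Y Y∈N)) (subst (_ ≤_) ∣Y′∣≡d (m≤ Y′ Y′∈N))

dmin-ext : ∀ {k} (N N′ : SetSystem k) → (∀ Y → D N Y ≡ D N′ Y) → dmin N ≡ dmin N′
dmin-ext {k} N N′ same
  rewrite ListP.filter-≐ (λ Y → Bool._≟_ (D N Y) true) (λ Y → Bool._≟_ (D N′ Y) true)
            ((λ {Y} → trans (sym (same Y))) , (λ {Y} → trans (same Y))) (allSubsets k)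
  = refl

△-assoc : ∀ {k} (A B C : Subset k) → (A △ B) △ C ≡ A △ (B △ C)
△-assoc = VecP.zipWith-assoc xor-assoc

△-comm : ∀ {k} (A B : Subset k) → A △ B ≡ B △ A
△-comm = VecP.zipWith-comm xor-comm

△-identityʳ : ∀ {k} (A : Subset k) → A △ ⊥ ≡ A
△-identityʳ = VecP.zipWith-identityʳ xor-identityʳ

△-self : ∀ {k} (A : Subset k) → A △ A ≡ ⊥
△-self [] = refl
△-self (a ∷ A) = cong₂ _∷_ (xor-same a) (△-self A)

△-involutive : ∀ {k} (A B : Subset k) → (A △ B) △ B ≡ A
△-involutive A B = trans (△-assoc A B B) (trans (cong (A △_) (△-self B)) (△-identityʳ A))

△-swap : ∀ {k} (A B C : Subset k) → (A △ B) △ C ≡ (A △ C) △ B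
△-swap A B C = begin
  (A △ B) △ C ≡⟨ △-assoc A B C ⟩
  A △ (B △ C) ≡⟨ cong (A △_) (△-comm B C) ⟩
  A △ (C △ B) ≡⟨ △-assoc A C B ⟨
  (A △ C) △ B ∎
  where open ≡-Reasoning

△-cancelʳ : ∀ {k} (A B S : Subset k) → (A △ S) △ (B △ S) ≡ A △ B
△-cancelʳ A B S = begin
  (A △ S) △ (B △ S) ≡⟨ cong ((A △ S) △_) (△-comm B S) ⟩
  (A △ S) △ (S △ B) ≡⟨ △-assoc (A △ S) S B ⟨
  ((A △ S) △ S) △ B ≡⟨ cong (_△ B) (△-involutive A S) ⟩
  A △ B ∎
  where open ≡-Reasoning

insertAt-△ : ∀ {k} (A B : Subset k) u c d →
  insertAt A u c △ insertAt B u d ≡ insertAt (A △ B) u (c xor d)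
insertAt-△ A B zero c d = refl
insertAt-△ (a ∷ A) (b ∷ B) (suc u) c d = cong ((a xor b) ∷_) (insertAt-△ A B u c d)

lookup-insertAt-△ : ∀ {k} (A B : Subset k) u c d →
  lookup (insertAt A u c △ insertAt B u d) u ≡ c xor d
lookup-insertAt-△ A B u c d =
  trans (cong (λ S → lookup S u) (insertAt-△ A B u c d)) (VecP.insertAt-lookup (A △ B) u (c xor d))

⁅⁆-insertAt : ∀ {k} (u : Fin (suc k)) → ⁅ u ⁆ ≡ insertAt ⊥ u true
⁅⁆-insertAt zero = refl
⁅⁆-insertAt {suc k} (suc u) = cong (false ∷_) (⁅⁆-insertAt u)

insertAt-twist : ∀ {k} (X : Subset k) u c → insertAt X u c △ ⁅ u ⁆ ≡ insertAt X u (not c)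
insertAt-twist X u c = begin
  insertAt X u c △ ⁅ u ⁆          ≡⟨ cong (insertAt X u c △_) (⁅⁆-insertAt u) ⟩
  insertAt X u c △ insertAt ⊥ u true ≡⟨ insertAt-△ X ⊥ u c true ⟩
  insertAt (X △ ⊥) u (c xor true)
    ≡⟨ cong₂ (λ Z b → insertAt Z u b) (△-identityʳ X) (xor-comm c true) ⟩
  insertAt X u (not c) ∎
  where open ≡-Reasoning

card-insertAt : ∀ {k} (A : Subset k) u b → ∣ insertAt A u b ∣ ≡ ∣ b ∷ A ∣
card-insertAt A zero b = refl
card-insertAt (a ∷ A) (suc u) b =
  trans (card-cons a {insertAt A u b} {b ∷ A} (card-insertAt A u b)) (card-swap a b)
  where
  card-cons : ∀ {k} a {B C : Subset k} → ∣ B ∣ ≡ ∣ C ∣ → ∣ a ∷ B ∣ ≡ ∣ a ∷ C ∣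
  card-cons true = cong suc
  card-cons false eq = eq
  card-swap : ∀ a b → ∣ a ∷ b ∷ A ∣ ≡ ∣ b ∷ a ∷ A ∣
  card-swap true true = refl
  card-swap true false = refl
  card-swap false true = refl
  card-swap false false = refl

distance-insertAt : ∀ {k} (A B : Subset k) u c d →
  ∣ insertAt A u c △ insertAt B u d ∣ ≡ ∣ (c xor d) ∷ (A △ B) ∣
distance-insertAt A B u c d = trans (cong ∣_∣ (insertAt-△ A B u c d)) (card-insertAt (A △ B) u (c xor d))

insertAt-removeAt′ : ∀ {k} (W : Subset (suc k)) u {b} →
  lookup W u ≡ b → insertAt (removeAt W u) u b ≡ W
insertAt-removeAt′ W u refl = VecP.insertAt-removeAt W u

insertAt-elim : ∀ {k} (u : Fin (suc k)) (P : Subset (suc k) → Set) →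
  (∀ Y′ b → P (insertAt Y′ u b)) → ∀ Y → P Y
insertAt-elim u P holds Y = subst P (insertAt-removeAt′ Y u refl) (holds (removeAt Y u) (lookup Y u))

toggle-≤ : ∀ {k} (A : Subset k) i → ∣ A △ ⁅ i ⁆ ∣ ≤ suc ∣ A ∣
toggle-≤ (true ∷ A) zero rewrite △-identityʳ A = ℕP.≤-trans (ℕP.n≤1+n _) (ℕP.n≤1+n _)
toggle-≤ (false ∷ A) zero rewrite △-identityʳ A = ℕP.≤-refl
toggle-≤ (true ∷ A) (suc i) = s≤s (toggle-≤ A i)
toggle-≤ (false ∷ A) (suc i) = toggle-≤ A i

toggle-member : ∀ {k} (A : Subset k) i → lookup A i ≡ true → suc ∣ A △ ⁅ i ⁆ ∣ ≡ ∣ A ∣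
toggle-member (true ∷ A) zero refl rewrite △-identityʳ A = refl
toggle-member (true ∷ A) (suc i) i∈A = cong suc (toggle-member A i i∈A)
toggle-member (false ∷ A) (suc i) i∈A = toggle-member A i i∈A

exchange-≤ : ∀ {k} (A : Subset k) u y →
  lookup A u ≡ true → ∣ A △ (⁅ u ⁆ ∪ ⁅ y ⁆) ∣ ≤ ∣ A ∣
exchange-≤ {suc k} (true ∷ A) zero zero refl
  rewrite ∪-identityˡ {n = k} ⊥ | △-identityʳ A = ℕP.n≤1+n _
exchange-≤ (true ∷ A) zero (suc y) refl rewrite ∪-identityˡ ⁅ y ⁆ = toggle-≤ A y
exchange-≤ (true ∷ A) (suc u) zero u∈A rewrite ∪-identityʳ ⁅ u ⁆ = toggle-≤ A u
exchange-≤ (false ∷ A) (suc u) zero u∈A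
  rewrite ∪-identityʳ ⁅ u ⁆ = ℕP.≤-reflexive (toggle-member A u u∈A)
exchange-≤ (true ∷ A) (suc u) (suc y) u∈A = s≤s (exchange-≤ A u y u∈A)
exchange-≤ (false ∷ A) (suc u) (suc y) u∈A = exchange-≤ A u y u∈A

proper-twist : ∀ {k} (N : SetSystem k) S → Proper N → Proper (N ✶ S)
proper-twist N S (Y , Y∈N) = Y △ S , subst (_∈D N) (sym (△-involutive Y S)) Y∈N

-- Twisting preserves Δ-matroids: N * S has the exchange property because
-- (X △ S) △ (Y △ S) = X △ Y.
twist-Δ : ∀ {k} (N : SetSystem k) S → IsDeltaMatroid N → IsDeltaMatroid (N ✶ S)
twist-Δ N S (proper , exchange) = proper-twist N S proper , exchange′
  where
  exchange′ : ∀ X Y → X ∈D (N ✶ S) → Y ∈D (N ✶ S) → ∀ x → x ∈ (X △ Y) →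
    ∃ λ y → y ∈ (X △ Y) × ((X △ (⁅ x ⁆ ∪ ⁅ y ⁆)) ∈D (N ✶ S))
  exchange′ X Y X∈ Y∈ x x∈
    with exchange (X △ S) (Y △ S) X∈ Y∈ x (subst (x ∈_) (sym (△-cancelʳ X Y S)) x∈)
  ... | y , y∈ , moved =
    y , subst (y ∈_) (△-cancelʳ X Y S) y∈ , subst (_∈D N) (△-swap X S _) moved

lookup-twist : ∀ {k} (Y : Subset k) u → lookup (Y △ ⁅ u ⁆) u ≡ not (lookup Y u)
lookup-twist Y u = begin
  lookup (Y △ ⁅ u ⁆) u         ≡⟨ VecP.lookup-zipWith _xor_ u Y ⁅ u ⁆ ⟩
  lookup Y u xor lookup ⁅ u ⁆ u ≡⟨ cong (lookup Y u xor_) (VecP.[]=⇒lookup (x∈⁅x⁆ u)) ⟩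
  lookup Y u xor true          ≡⟨ xor-comm (lookup Y u) true ⟩
  not (lookup Y u) ∎
  where open ≡-Reasoning

member-twist : ∀ {k} (Y : Subset k) u → u ∈ (Y △ ⁅ u ⁆) → u ∉ Y
member-twist Y u u∈twisted u∈Y = false≢true (begin
  false                  ≡⟨ cong not (VecP.[]=⇒lookup u∈Y) ⟨
  not (lookup Y u)       ≡⟨ lookup-twist Y u ⟨
  lookup (Y △ ⁅ u ⁆) u   ≡⟨ VecP.[]=⇒lookup u∈twisted ⟩
  true ∎)
  where
  open ≡-Reasoning
  false≢true : false ≢ true
  false≢true ()

coloop⇒twist-loop : ∀ {k} (N : SetSystem k) u → IsColoop N u → IsLoop (N ✶₁ u) u
coloop⇒twist-loop N u coloop Y Y∈ = member-twist Y u (coloop (Y △ ⁅ u ⁆) Y∈)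

twist-coloop⇒loop : ∀ {k} (N : SetSystem k) u → IsColoop (N ✶₁ u) u → IsLoop N u
twist-coloop⇒loop N u coloop Y Y∈N =
  member-twist Y u (coloop (Y △ ⁅ u ⁆) (subst (_∈D N) (sym (△-involutive Y ⁅ u ⁆)) Y∈N))

deletion-proper : ∀ {k} (N : SetSystem (suc k)) u → ¬ IsColoop N u → Proper (N ∖ u)
deletion-proper N u notColoop
  with subset-search (λ Y → (Bool._≟_ (D N Y) true) ×-dec (Bool._≟_ (lookup Y u) false))
         (λ none → notColoop λ Y Y∈N → VecP.lookup⇒[]= u Y (¬-not λ u∉Y → none Y (Y∈N , u∉Y)))
... | Y , Y∈N , u∉Y = removeAt Y u , subst (_∈D N) (sym (insertAt-removeAt′ Y u u∉Y)) Y∈N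

loop⇒¬coloop : ∀ {k} (N : SetSystem k) u → Proper N → IsLoop N u → ¬ IsColoop N u
loop⇒¬coloop N u (Y , Y∈N) loop coloop = loop Y Y∈N (coloop Y Y∈N)

twist-insertAt : ∀ {k} (N : SetSystem (suc k)) u X′ c Y′ b →
  D (N ✶ insertAt X′ u c) (insertAt Y′ u b) ≡ D N (insertAt (Y′ △ X′) u (b xor c))
twist-insertAt N u X′ c Y′ b = cong (D N) (insertAt-△ Y′ X′ u b c)

Dominated : ∀ {k} → SetSystem (suc k) → Fin (suc k) → Set
Dominated N u = ∀ X′ Y′ → insertAt Y′ u true ∈D N →
  ∃ λ W′ → W′ ∈D (N ∖ u) × ∣ W′ △ X′ ∣ ≤ suc ∣ Y′ △ X′ ∣

-- In a Δ-matroid with a member avoiding u, exchanging a member containing u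
-- against it at u yields a member W avoiding u with W △ X ⊆ (Y △ X) △ {u, y}.
Δ-dominated : ∀ {k} (N : SetSystem (suc k)) u → IsDeltaMatroid N → Proper (N ∖ u) → Dominated N u
Δ-dominated N u (_ , exchange) (Z′ , Z∈N) X′ Y′ Y∈N
  with exchange (insertAt Y′ u true) (insertAt Z′ u false) Y∈N Z∈N u
         (VecP.lookup⇒[]= u _ (lookup-insertAt-△ Y′ Z′ u true false))
... | y , _ , W∈N = removeAt W u , subst (_∈D N) (sym W-split) W∈N , closer
  where
  Y X T W : Subset _
  Y = insertAt Y′ u true
  X = insertAt X′ u false
  T = ⁅ u ⁆ ∪ ⁅ y ⁆
  W = Y △ T
  u∈T : lookup T u ≡ true
  u∈T = VecP.[]=⇒lookup (p⊆p∪q ⁅ y ⁆ (x∈⁅x⁆ u))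
  W-split : insertAt (removeAt W u) u false ≡ W
  W-split = insertAt-removeAt′ W u
    (trans (VecP.lookup-zipWith _xor_ u Y T) (cong₂ _xor_ (VecP.insertAt-lookup Y′ u true) u∈T))
  closer : ∣ removeAt W u △ X′ ∣ ≤ suc ∣ Y′ △ X′ ∣
  closer = begin
    ∣ removeAt W u △ X′ ∣                    ≡⟨ distance-insertAt (removeAt W u) X′ u false false ⟨
    ∣ insertAt (removeAt W u) u false △ X ∣  ≡⟨ cong (λ S → ∣ S △ X ∣) W-split ⟩
    ∣ (Y △ T) △ X ∣                          ≡⟨ cong ∣_∣ (△-swap Y T X) ⟩
    ∣ (Y △ X) △ T ∣
      ≤⟨ exchange-≤ (Y △ X) u y (lookup-insertAt-△ Y′ X′ u true false) ⟩
    ∣ Y △ X ∣                                ≡⟨ distance-insertAt Y′ X′ u true false ⟩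
    suc ∣ Y′ △ X′ ∣ ∎
    where open ℕP.≤-Reasoning

loop-excludes : ∀ {k} (N : SetSystem (suc k)) u → IsLoop N u → ∀ Y′ → ¬ (insertAt Y′ u true ∈D N)
loop-excludes N u loop Y′ Y∈N = loop _ Y∈N (VecP.lookup⇒[]= u _ (VecP.insertAt-lookup Y′ u true))

loop-dominated : ∀ {k} (N : SetSystem (suc k)) u → IsLoop N u → Dominated N u
loop-dominated N u loop X′ Y′ Y∈N = ⊥-elim (loop-excludes N u loop Y′ Y∈N)

dmin-avoid : ∀ {k} (N : SetSystem (suc k)) u → Proper (N ∖ u) → Dominated N u →
  ∀ X′ → dmin (N ✶ insertAt X′ u false) ≡ dmin ((N ∖ u) ✶ X′)
dmin-avoid N u proper dominated X′ = minSize-dmin (N ✶ insertAt X′ u false) (attained , lower)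
  where
  a = dmin ((N ∖ u) ✶ X′)
  deleted : MinSize ((N ∖ u) ✶ X′) a
  deleted = dmin-minSize ((N ∖ u) ✶ X′) (proper-twist (N ∖ u) X′ proper)
  attained : ∃ λ Y → Y ∈D (N ✶ insertAt X′ u false) × ∣ Y ∣ ≡ a
  attained with proj₁ deleted
  ... | Y₀ , Y₀∈ , ∣Y₀∣≡a = insertAt Y₀ u false
    , trans (twist-insertAt N u X′ false Y₀ false) Y₀∈ , trans (card-insertAt Y₀ u false) ∣Y₀∣≡a
  bound : ∀ Y′ b → insertAt Y′ u b ∈D (N ✶ insertAt X′ u false) → a ≤ ∣ insertAt Y′ u b ∣
  bound Y′ false Y∈ = subst (a ≤_) (sym (card-insertAt Y′ u false))
    (proj₂ deleted Y′ (trans (sym (twist-insertAt N u X′ false Y′ false)) Y∈))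
  bound Y′ true Y∈
    with dominated X′ (Y′ △ X′) (trans (sym (twist-insertAt N u X′ false Y′ true)) Y∈)
  ... | W′ , W∈N , closer = begin
    a                    ≤⟨ proj₂ deleted (W′ △ X′)
                              (subst (λ Z → insertAt Z u false ∈D N) (sym (△-involutive W′ X′)) W∈N) ⟩
    ∣ W′ △ X′ ∣          ≤⟨ closer ⟩
    suc ∣ (Y′ △ X′) △ X′ ∣ ≡⟨ cong (λ Z → suc ∣ Z ∣) (△-involutive Y′ X′) ⟩
    suc ∣ Y′ ∣           ≡⟨ card-insertAt Y′ u true ⟨
    ∣ insertAt Y′ u true ∣ ∎
    where open ℕP.≤-Reasoning
  lower : ∀ Y → Y ∈D (N ✶ insertAt X′ u false) → a ≤ ∣ Y ∣
  lower = insertAt-elim u _ bound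

dmin-loop : ∀ {k} (N : SetSystem (suc k)) u → IsLoop N u → Proper (N ∖ u) →
  ∀ X′ → dmin (N ✶ insertAt X′ u true) ≡ suc (dmin ((N ∖ u) ✶ X′))
dmin-loop N u loop proper X′ = minSize-dmin (N ✶ insertAt X′ u true) (attained , lower)
  where
  a = dmin ((N ∖ u) ✶ X′)
  deleted : MinSize ((N ∖ u) ✶ X′) a
  deleted = dmin-minSize ((N ∖ u) ✶ X′) (proper-twist (N ∖ u) X′ proper)
  attained : ∃ λ Y → Y ∈D (N ✶ insertAt X′ u true) × ∣ Y ∣ ≡ suc a
  attained with proj₁ deleted
  ... | Y₀ , Y₀∈ , ∣Y₀∣≡a = insertAt Y₀ u true
    , trans (twist-insertAt N u X′ true Y₀ true) Y₀∈
    , trans (card-insertAt Y₀ u true) (cong suc ∣Y₀∣≡a)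
  bound : ∀ Y′ b → insertAt Y′ u b ∈D (N ✶ insertAt X′ u true) → suc a ≤ ∣ insertAt Y′ u b ∣
  bound Y′ true Y∈ = subst (suc a ≤_) (sym (card-insertAt Y′ u true))
    (s≤s (proj₂ deleted Y′ (trans (sym (twist-insertAt N u X′ true Y′ true)) Y∈)))
  bound Y′ false Y∈ =
    ⊥-elim (loop-excludes N u loop (Y′ △ X′) (trans (sym (twist-insertAt N u X′ true Y′ false)) Y∈))
  lower : ∀ Y → Y ∈D (N ✶ insertAt X′ u true) → suc a ≤ ∣ Y ∣
  lower = insertAt-elim u _ bound

term : ∀ {k} → SetSystem k → ℤ → Subset k → ℤ
term N y X = sign ∣ X ∣ * (y ^ dmin (N ✶ X))

pairTerm : ∀ {k} → SetSystem (suc k) → Fin (suc k) → ℤ → Subset k → ℤ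
pairTerm N u y X′ =
  sign ∣ X′ ∣ * (y ^ dmin (N ✶ insertAt X′ u false) - y ^ dmin (N ✶ insertAt X′ u true))

-- p₁(N) = Σ_{X′ ⊆ V∖u} (-1)^|X′| (y^d(N * X′) - y^d(N * (X′+u))), since |X′+u| = 1 + |X′|.
p₁-split : ∀ {k} (N : SetSystem (suc k)) u y → p₁ N y ≡ Σₛ k (pairTerm N u y)
p₁-split {k} N u y = trans (Σₛ-insertAt k u (term N y)) (Σₛ-ext k paired)
  where
  regroup : ∀ s t f → (- s) * t + s * f ≡ s * (f - t)
  regroup = solve-∀
  paired : ∀ X′ → term N y (insertAt X′ u true) + term N y (insertAt X′ u false) ≡ pairTerm N u y X′
  paired X′ = trans
    (cong₂ (λ s t → sign s * (y ^ dmin (N ✶ insertAt X′ u true))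
                    + sign t * (y ^ dmin (N ✶ insertAt X′ u false)))
      (card-insertAt X′ u true) (card-insertAt X′ u false))
    (regroup (sign ∣ X′ ∣) _ _)

dmin-twist : ∀ {k} (N : SetSystem (suc k)) u X′ c →
  dmin ((N ✶₁ u) ✶ insertAt X′ u c) ≡ dmin (N ✶ insertAt X′ u (not c))
dmin-twist N u X′ c = dmin-ext _ _ λ Y →
  cong (D N) (trans (△-assoc Y (insertAt X′ u c) ⁅ u ⁆) (cong (Y △_) (insertAt-twist X′ u c)))

-- Twisting by u swaps the two halves of the split and so negates p₁.
p₁-twist : ∀ {k} (N : SetSystem (suc k)) u y → p₁ N y ≡ - p₁ (N ✶₁ u) y
p₁-twist {k} N u y = begin
  p₁ N y                                    ≡⟨ p₁-split N u y ⟩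
  Σₛ k (pairTerm N u y)                     ≡⟨ Σₛ-ext k swapped ⟩
  Σₛ k (λ X′ → - pairTerm (N ✶₁ u) u y X′)  ≡⟨ sum-map-neg _ (allSubsets k) ⟩
  - Σₛ k (pairTerm (N ✶₁ u) u y)            ≡⟨ cong -_ (p₁-split (N ✶₁ u) u y) ⟨
  - p₁ (N ✶₁ u) y ∎
  where
  open ≡-Reasoning
  antisym : ∀ s a b → s * (a - b) ≡ - (s * (b - a))
  antisym = solve-∀
  swapped : ∀ X′ → pairTerm N u y X′ ≡ - pairTerm (N ✶₁ u) u y X′
  swapped X′ = trans
    (antisym (sign ∣ X′ ∣) (y ^ dmin (N ✶ insertAt X′ u false)) (y ^ dmin (N ✶ insertAt X′ u true)))
    (cong₂ (λ d e → - (sign ∣ X′ ∣ * (y ^ d - y ^ e)))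
      (sym (dmin-twist N u X′ false)) (sym (dmin-twist N u X′ true)))

p₁-generic : ∀ {k} (N : SetSystem (suc k)) u → IsDeltaMatroid N → ¬ IsLoop N u → ¬ IsColoop N u →
  ∀ y → p₁ N y ≡ p₁ (N ∖ u) y - p₁ ((N ✶₁ u) ∖ u) y
p₁-generic {k} N u Δ notLoop notColoop y =
  trans (p₁-split N u y) (trans (Σₛ-ext k per-subset) (sum-map-- _ _ (allSubsets k)))
  where
  deleted-proper : Proper (N ∖ u)
  deleted-proper = deletion-proper N u notColoop
  contracted-proper : Proper ((N ✶₁ u) ∖ u)
  contracted-proper = deletion-proper (N ✶₁ u) u (λ c → notLoop (twist-coloop⇒loop N u c))
  avoid : ∀ X′ → dmin (N ✶ insertAt X′ u false) ≡ dmin ((N ∖ u) ✶ X′)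
  avoid = dmin-avoid N u deleted-proper (Δ-dominated N u Δ deleted-proper)
  contain : ∀ X′ → dmin (N ✶ insertAt X′ u true) ≡ dmin (((N ✶₁ u) ∖ u) ✶ X′)
  contain X′ = trans (sym (dmin-twist N u X′ false))
    (dmin-avoid (N ✶₁ u) u contracted-proper
      (Δ-dominated (N ✶₁ u) u (twist-Δ N ⁅ u ⁆ Δ) contracted-proper) X′)
  distrib : ∀ s a b → s * (a - b) ≡ s * a - s * b
  distrib = solve-∀
  per-subset : ∀ X′ → pairTerm N u y X′ ≡ term (N ∖ u) y X′ - term ((N ✶₁ u) ∖ u) y X′
  per-subset X′ = trans (cong₂ (λ a b → sign ∣ X′ ∣ * (y ^ a - y ^ b)) (avoid X′) (contain X′))
    (distrib (sign ∣ X′ ∣) _ _)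

p₁-loop : ∀ {k} (N : SetSystem (suc k)) u → Proper N → IsLoop N u →
  ∀ y → p₁ N y ≡ (1ℤ - y) * p₁ (N ∖ u) y
p₁-loop {k} N u proper loop y =
  trans (p₁-split N u y) (trans (Σₛ-ext k per-subset) (sum-map-scale (1ℤ - y) _ (allSubsets k)))
  where
  deleted-proper : Proper (N ∖ u)
  deleted-proper = deletion-proper N u (loop⇒¬coloop N u proper loop)
  factor : ∀ s y a → s * (a - y * a) ≡ (1ℤ - y) * (s * a)
  factor = solve-∀
  per-subset : ∀ X′ → pairTerm N u y X′ ≡ (1ℤ - y) * term (N ∖ u) y X′
  per-subset X′ = trans
    (cong₂ (λ a b → sign ∣ X′ ∣ * (y ^ a - y ^ b))
      (dmin-avoid N u deleted-proper (loop-dominated N u loop) X′) (dmin-loop N u loop deleted-proper X′))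
    (factor (sign ∣ X′ ∣) y _)

corollary6 : ∀ {n} (M : SetSystem (suc n)) (u : Fin (suc n)) → IsDeltaMatroid M →
    ((¬ IsLoop M u) → (¬ IsColoop M u) →
       ∀ (y : ℤ) → p₁ M y ≡ p₁ (M ∖ u) y - p₁ ((M ✶₁ u) ∖ u) y)
    × (IsLoop M u → ∀ (y : ℤ) → p₁ M y ≡ (1ℤ - y) * p₁ (M ∖ u) y)
    × (IsColoop M u → ∀ (y : ℤ) → p₁ M y ≡ (y - 1ℤ) * p₁ ((M ✶₁ u) ∖ u) y)
corollary6 M u Δ = p₁-generic M u Δ , p₁-loop M u (proj₁ Δ) , coloop-case
  where
  -- a coloop of M is a loop of M * u, and p₁(M) = -p₁(M * u)
  coloop-case : IsColoop M u → ∀ y → p₁ M y ≡ (y - 1ℤ) * p₁ ((M ✶₁ u) ∖ u) y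
  coloop-case coloop y = begin
    p₁ M y
      ≡⟨ p₁-twist M u y ⟩
    - p₁ (M ✶₁ u) y
      ≡⟨ cong -_ (p₁-loop (M ✶₁ u) u twisted-proper (coloop⇒twist-loop M u coloop) y) ⟩
    - ((1ℤ - y) * p₁ ((M ✶₁ u) ∖ u) y)
      ≡⟨ flip-sign y _ ⟩
    (y - 1ℤ) * p₁ ((M ✶₁ u) ∖ u) y ∎
    where
    open ≡-Reasoning
    twisted-proper : Proper (M ✶₁ u)
    twisted-proper = proper-twist M ⁅ u ⁆ (proj₁ Δ)
    flip-sign : ∀ y p → - ((1ℤ - y) * p) ≡ (y - 1ℤ) * p
    flip-sign = solve-∀
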